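{- Let $N\ge 1$ and $r\ge 2$ be integers with $N+1\ge r$, let $\Delta_N$ be the $N$-simplex with vertex set $\{v_0,\dots,v_N\}$, and let $Y_{N,r}$ be the prism complex defined in the context. Then $Y_{N,r}$, with this prism cell structure, is $\mathcal{O}$-orientable.
   Context: For a nonempty set $V$ of vertices of $\Delta_N$, let $\Delta(V)$ denote the face of $\Delta_N$ spanned by $V$, a simplex of dimension $|V|-1$. The complex $Y_{N,r}$ is the space of ordered $r$-tuples $(y_1,\dots,y_r)$ of points of $\Delta_N$ such that the points $y_1,\dots,y_r$ lie in pairwise disjoint faces of $\Delta_N$. It is a CW complex whose cells are the products $\Delta(V_1)\times\cdots\times\Delta(V_r)$, where $(V_1,\dots,V_r)$ ranges over ordered $r$-tuples of pairwise disjoint nonempty subsets of $\{v_0,\dots,v_N\}$. Such a complex, in which every cell carries the structure of a product of simplices, is called a prism complex. The top-dimensional cells have dimension $N-r+1$; they correspond to ordered partitions $(V_1,\dots,V_r)$ of the whole vertex set into $r$ nonempty parts. The codimension-one cells correspond to ordered $r$-tuples of pairwise disjoint nonempty subsets whose union misses exactly one vertex. Orientations are handled as follows. An orientation of a simplex $\Delta(V)$ with $|V|\ge 2$ is given by a total order of $V$, up to even permutations. An orientation of a $0$-simplex is a sign $\pm1$. An orientation of a product cell is the ordered product of orientations of its factors. Boundary orientations are the standard induced ones. For a simplex ordered as $(v_{i_0},\dots,v_{i_s})$, the boundary is $\partial\Delta(v_{i_0},\dots,v_{i_s})=\sum_{j=0}^s(-1)^j\Delta(v_{i_0},\dots,\widehat{v_{i_j}},\dots,v_{i_s})$;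 in particular $\partial\Delta(a,b)=(b)-(a)$, where a singleton receives the sign of its term. For a product cell, the Leibniz rule applies: $\partial[\Delta(V_1)\times\cdots\times\Delta(V_r)]=\sum_{k=1}^r(-1)^{\dim(\Delta(V_1)\times\cdots\times\Delta(V_{k-1}))}\Delta(V_1)\times\cdots\times\partial\Delta(V_k)\times\cdots\times\Delta(V_r)$. This determines the orientation that a codimension-one cell inherits from each oriented top-dimensional cell in whose boundary it lies. A prism CW complex $Y$ of dimension $d$ is called $\mathcal{O}$-orientable if one can choose orientations of all its $d$-cells such that every cell of codimension $1$ inherits the same orientation from all $d$-dimensional cells to which it is incident. -}

module Defs where

open import Data.Nat using (ℕ; zero; suc; _+_; _∸_; _<_; _≤_)
open import Data.Fin using (Fin; zero; suc; _<?_; _≟_)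
open import Data.Bool using (if_then_else_; true; false)
open import Data.List using (List; []; _∷_; length; filter)
open import Data.Maybe using (Maybe; just; nothing)
open import Data.Vec using (Vec; lookup; map; _[_]≔_)
open import Data.Sign using (Sign) renaming (_*_ to _*ₛ_)
open import Data.Product using (Σ; ∃; _×_)
open import Function using (_∘_)
open import Function.Bundles using (_⇔_)
open import Relation.Nullary using (¬_; does)
open import Relation.Nullary.Decidable using (¬?)
open import Relation.Binary.PropositionalEquality using (_≡_; _≢_)
open import Data.List.Membership.Propositional using (_∈_)
open import Data.List.Relation.Unary.Unique.Propositional using (Unique)
open import Data.List.Relation.Binary.Permutation.Propositional using (_↭_)

Vertex : ℕ → Set
Vertex N = Fin (suc N)

signPow : ℕ → Sign
signPow zero    = Sign.+
signPow (suc n) = Sign.- *ₛ signPow n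

inversions : ∀ {n} → List (Fin n) → ℕ
inversions []       = 0
inversions (x ∷ xs) = length (filter (λ y → y <? x) xs) + inversions xs

-- Two total orders of the same set give the same simplex orientation iff
-- their signs agree (i.e. they differ by an even permutation).
orderSign : ∀ {n} → List (Fin n) → Sign
orderSign l = signPow (inversions l)

prodSign : ∀ {r} → (Fin r → Sign) → Sign
prodSign {zero}  f = Sign.+
prodSign {suc r} f = f zero *ₛ prodSign (f ∘ suc)

-- dim(Δ(V_1) × ... × Δ(V_{k-1})) where V_i is the set of entries of σ i
prefixDim : ∀ {r} {A : Set} → (Fin r → List A) → Fin r → ℕ
prefixDim σ zero    = 0
prefixDim σ (suc k) = (length (σ zero) ∸ 1) + prefixDim (σ ∘ suc) k

indexOf : ∀ {n} → Fin n → List (Fin n) → ℕ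
indexOf v []       = 0
indexOf v (x ∷ xs) = if does (x ≟ v) then 0 else suc (indexOf v xs)

-- A cell (V_1,...,V_r) is encoded by a vector c : Vec (Maybe (Fin r)) (suc N)
-- with  lookup c v ≡ just k  iff  v ∈ V_k,  nothing iff v lies in no V_k.
-- A top-dimensional cell (ordered partition) is encoded by T : Vec (Fin r) (suc N)
-- such that every part is nonempty.

IsTopCell : ∀ {N r} → Vec (Fin r) (suc N) → Set
IsTopCell {N} {r} T = ∀ (k : Fin r) → ∃ λ (v : Vertex N) → lookup T v ≡ k

-- Oriented product cell: a total order of each factor V_k together with
-- a global sign ε; it represents ε · Δ(order 1) × ... × Δ(order r).
-- (The orientation of a 0-dimensional factor is a sign, absorbed into ε.)
record OrientedCell (N r : ℕ) : Set where
  constructor oc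
  field
    order : Fin r → List (Vertex N)
    sign  : Sign
open OrientedCell public

-- Two oriented cells give the same oriented cell: same underlying sets
-- V_1,...,V_r, and the orientations agree (total orders up to even
-- permutations, signs of 0-simplices, combined as an ordered product).
SameOrientation : ∀ {N r} → OrientedCell N r → OrientedCell N r → Set
SameOrientation o o' =
  (∀ k → order o k ↭ order o' k) ×
  (sign o *ₛ prodSign (λ k → orderSign (order o k))
     ≡ sign o' *ₛ prodSign (λ k → orderSign (order o' k)))

record Orientation {N r : ℕ} (T : Vec (Fin r) (suc N)) : Set where
  field
    cell   : OrientedCell N r
    unique : ∀ k → Unique (order cell k)
    mem    : ∀ k (v : Vertex N) → (v ∈ order cell k) ⇔ (lookup T v ≡ k)
open Orientation public

face : ∀ {N r} → Vec (Fin r) (suc N) → Vertex N → Vec (Maybe (Fin r)) (suc N)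
face T v = map just T [ v ]≔ nothing

-- The face `face T v` lies in the boundary of T iff the part containing v
-- has at least two vertices (a 0-simplex has empty boundary).
FaceOf : ∀ {N r} → Vec (Fin r) (suc N) → Vertex N → Set
FaceOf {N} T v = ∃ λ (w : Vertex N) → (w ≢ v) × (lookup T w ≡ lookup T v)

updateOrder : ∀ {N r} → (Fin r → List (Vertex N)) → Fin r → List (Vertex N)
            → Fin r → List (Vertex N)
updateOrder σ k l i = if does (i ≟ k) then l else σ i

-- Induced boundary orientation on `face T v` from the oriented cell o of T,
-- via the simplex boundary formula and the Leibniz rule:
--   sign (-1)^(dim of factors before k + position of v in the order of V_k).
induced : ∀ {N r} → Vec (Fin r) (suc N) → OrientedCell N r → Vertex N → OrientedCell N r
induced T o v =
  let k = lookup T v in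
  oc (updateOrder (order o) k (filter (λ x → ¬? (x ≟ v)) (order o k)))
     (sign o *ₛ signPow (prefixDim (order o) k + indexOf v (order o k)))

OOrientable : ℕ → ℕ → Set
OOrientable N r =
  Σ ((T : Vec (Fin r) (suc N)) → IsTopCell T → Orientation T) λ ω →
    ∀ (T T' : Vec (Fin r) (suc N)) (hT : IsTopCell T) (hT' : IsTopCell T')
      (v v' : Vertex N) → FaceOf T v → FaceOf T' v' →
      face T v ≡ face T' v' →
      SameOrientation (induced T (cell (ω T hT)) v) (induced T' (cell (ω T' hT')) v')

-- Order each part V_k of a top cell increasingly and give the cell the sign
-- (-1)^(inv(V_1 ⋯ V_r) + Σ_v k(v)), where inv counts inversions of the
-- concatenated word V_1 ⋯ V_r and k(v) is the index of the part containing v.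
-- Deleting v from part k contributes the boundary sign (-1)^(dim(V_1 × ⋯ × V_{k-1}) + pos_k(v)),
-- and pos_k(v) + dim(V_1 × ⋯ × V_{k-1}) + k is the position of v in the whole word.
-- Moving v to the front of the word changes inv by exactly that position (mod 2),
-- and Σ k(v) loses the term k. So the induced orientation of a codimension-one
-- cell is (-1)^(inv(v ⋅ W_1 ⋯ W_r) + Σ_w k(w)), computed from the cell alone.
module Submission where

open import Defs
open import Data.Nat using (ℕ; zero; suc; _+_; _∸_; _≤_)
open import Data.Nat.Properties using (+-identityʳ; +-assoc; +-comm; m∸n+n≡m; +-commutativeSemigroup)
open import Algebra.Properties.CommutativeSemigroup +-commutativeSemigroup using (x∙yz≈y∙xz)
open import Data.Nat.Tactic.RingSolver using (solve-∀)
open import Data.Fin using (Fin; zero; suc; toℕ; _<?_; _≟_)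
open import Data.Fin.Properties using (<-cmp; suc-injective; 0≢1+n)
open import Data.Maybe using (Maybe; just; nothing; maybe)
open import Data.Maybe.Properties using (just-injective) renaming (≡-dec to ≡-decᵐ)
open import Data.Vec using (Vec; _∷_; lookup; map; sum; _[_]≔_)
open import Data.Vec.Properties using (lookup∘update; lookup∘update′; lookup-map)
open import Data.List using (List; []; _∷_; [_]; _++_; length; filter; concat; tabulate; allFin)
open import Data.List.Properties using (filter-++; filter-all; filter-accept; filter-reject; filter-≐; length-++; tabulate-cong)
open import Data.List.Relation.Unary.All as All using (All)
open import Data.List.Relation.Unary.All.Properties using (tabulate⁺)
open import Data.List.Relation.Unary.AllPairs using (_∷_)
open import Data.List.Relation.Unary.AllPairs.Properties as AllPairs using ()
open import Data.List.Relation.Unary.Any using (here; there)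
open import Data.List.Membership.Propositional using (_∈_)
open import Data.List.Membership.Propositional.Properties using (∈-filter⁺; ∈-filter⁻; ∈-allFin; ∈-length; ∈-concat⁺′; ∈-tabulate⁺)
open import Data.List.Relation.Unary.Unique.Propositional using (Unique)
open import Data.List.Relation.Unary.Unique.Propositional.Properties using (filter⁺; allFin⁺; concat⁺)
open import Data.List.Relation.Binary.Permutation.Propositional using (↭-reflexive)
open import Data.Sign using (Sign) renaming (_*_ to _*ₛ_)
open import Data.Sign.Properties using (*-assoc)
open import Data.Product using (∃; _×_; _,_; proj₂)
open import Function using (_∘_)
open import Function.Bundles using (mk⇔)
open import Relation.Binary using (tri<; tri≈; tri>; DecidableEquality)
open import Relation.Binary.PropositionalEquality using (_≡_; _≢_; refl; sym; trans; cong; cong₂; module ≡-Reasoning)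
open import Relation.Nullary using (¬_; yes; no)
open import Relation.Nullary.Decidable using (¬?; _×-dec_)
open import Data.Empty using (⊥-elim)
open import Level using (0ℓ)
open import Relation.Unary as U using (Pred)

signPow-+ : ∀ m n → signPow (m + n) ≡ signPow m *ₛ signPow n
signPow-+ zero    n = refl
signPow-+ (suc m) n =
  trans (cong (Sign.- *ₛ_) (signPow-+ m n)) (sym (*-assoc Sign.- (signPow m) (signPow n)))

signPow-cong-+ : ∀ {a a′ b b′} → signPow a ≡ signPow a′ → signPow b ≡ signPow b′ →
                 signPow (a + b) ≡ signPow (a′ + b′)
signPow-cong-+ {a} {a′} {b} {b′} p q =
  trans (signPow-+ a b) (trans (cong₂ _*ₛ_ p q) (sym (signPow-+ a′ b′)))

prodSign-cong : ∀ {r} {f g : Fin r → Sign} → (∀ i → f i ≡ g i) → prodSign f ≡ prodSign g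
prodSign-cong {zero}  eq = refl
prodSign-cong {suc r} eq = cong₂ _*ₛ_ (eq zero) (prodSign-cong (eq ∘ suc))

filter-filter : ∀ {A : Set} {P Q : Pred A 0ℓ} (P? : U.Decidable P) (Q? : U.Decidable Q) xs →
                filter P? (filter Q? xs) ≡ filter (λ x → P? x ×-dec Q? x) xs
filter-filter P? Q? []       = refl
filter-filter P? Q? (x ∷ xs) with Q? x
... | yes _ with P? x
...   | yes _ = cong (x ∷_) (filter-filter P? Q? xs)
...   | no  _ = filter-filter P? Q? xs
filter-filter P? Q? (x ∷ xs) | no _ with P? x
...   | yes _ = filter-filter P? Q? xs
...   | no  _ = filter-filter P? Q? xs

flatten : ∀ {r} {A : Set} → (Fin r → List A) → List A
flatten σ = concat (tabulate σ)

flatten-cong : ∀ {r} {A : Set} {σ τ : Fin r → List A} → (∀ i → σ i ≡ τ i) → flatten σ ≡ flatten τ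
flatten-cong = cong concat ∘ tabulate-cong

flatten-unique : ∀ {r} {A : Set} (σ : Fin r → List A) → (∀ i → Unique (σ i)) →
                 (∀ {i j x} → x ∈ σ i → x ∈ σ j → i ≡ j) → Unique (flatten σ)
flatten-unique σ unique disjoint =
  concat⁺ (tabulate⁺ unique) (AllPairs.tabulate⁺ (λ i≢j (x∈i , x∈j) → i≢j (disjoint x∈i x∈j)))

module _ {n : ℕ} where

  remove : Fin n → List (Fin n) → List (Fin n)
  remove v = filter (λ x → ¬? (x ≟ v))

  remove-absent : ∀ {v l} → All (v ≢_) l → remove v l ≡ l
  remove-absent {v} v∉l = filter-all (λ x → ¬? (x ≟ v)) (All.map (_∘ sym) v∉l)

  remove-flatten : ∀ {r} v (σ : Fin r → List (Fin n)) →
                   remove v (flatten σ) ≡ flatten (remove v ∘ σ)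
  remove-flatten {zero}  v σ = refl
  remove-flatten {suc r} v σ =
    trans (filter-++ (λ x → ¬? (x ≟ v)) (σ zero) (flatten (σ ∘ suc)))
          (cong (remove v (σ zero) ++_) (remove-flatten v (σ ∘ suc)))

  countBelow : Fin n → List (Fin n) → ℕ
  countBelow x ys = length (filter (_<? x) ys)

  countBelow-∷ : ∀ x y ys → countBelow x (y ∷ ys) ≡ countBelow x [ y ] + countBelow x ys
  countBelow-∷ x y ys =
    trans (cong length (filter-++ (_<? x) [ y ] ys)) (length-++ (filter (_<? x) [ y ]))

  countBelow-remove : ∀ x {v l} → v ∈ l → Unique l →
                      countBelow x l ≡ countBelow x [ v ] + countBelow x (remove v l)
  countBelow-remove x {v} {y ∷ l} v∈ (y∉l ∷ ul) with y ≟ v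
  ... | yes refl = trans (countBelow-∷ x y l)
                         (cong (λ m → countBelow x [ y ] + countBelow x m) (sym (remove-absent y∉l)))
  countBelow-remove x {v} {y ∷ l} (here v≡y)  _          | no y≢v = ⊥-elim (y≢v (sym v≡y))
  countBelow-remove x {v} {y ∷ l} (there v∈l) (_ ∷ ul)   | no y≢v = begin
    countBelow x (y ∷ l)                                    ≡⟨ countBelow-∷ x y l ⟩
    countBelow x [ y ] + countBelow x l                     ≡⟨ cong (countBelow x [ y ] +_) (countBelow-remove x v∈l ul) ⟩
    countBelow x [ y ] + (countBelow x [ v ] + countBelow x (remove v l))
      ≡⟨ x∙yz≈y∙xz (countBelow x [ y ]) (countBelow x [ v ]) (countBelow x (remove v l)) ⟩
    countBelow x [ v ] + (countBelow x [ y ] + countBelow x (remove v l))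
      ≡⟨ cong (countBelow x [ v ] +_) (sym (countBelow-∷ x y (remove v l))) ⟩
    countBelow x [ v ] + countBelow x (y ∷ remove v l)      ∎
    where open ≡-Reasoning

  countBelow-swap : ∀ {x y} → x ≢ y → signPow (countBelow x [ y ] + 1) ≡ signPow (countBelow y [ x ])
  countBelow-swap {x} {y} x≢y with <-cmp x y
  ... | tri< x<y _ y≮x = trans (cong (λ a → signPow (length a + 1)) (filter-reject (_<? x) y≮x))
                               (sym (cong (signPow ∘ length) (filter-accept (_<? y) x<y)))
  ... | tri≈ _ x≡y _   = ⊥-elim (x≢y x≡y)
  ... | tri> x≮y _ y<x = trans (cong (λ a → signPow (length a + 1)) (filter-accept (_<? x) y<x))
                               (sym (cong (signPow ∘ length) (filter-reject (_<? y) x≮y)))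

  inversions-moveToFront : ∀ v l → v ∈ l → Unique l →
    signPow (inversions l + indexOf v l) ≡ signPow (inversions (v ∷ remove v l))
  inversions-moveToFront v (y ∷ l) v∈ (y∉l ∷ ul) with y ≟ v
  ... | yes refl =
    cong signPow (trans (+-identityʳ _) (cong (λ m → inversions (y ∷ m)) (sym (remove-absent y∉l))))
  inversions-moveToFront v (y ∷ l) (here v≡y)  _ | no y≢v = ⊥-elim (y≢v (sym v≡y))
  inversions-moveToFront v (y ∷ l) (there v∈l) (_ ∷ ul) | no y≢v = begin
    signPow (countBelow y l + inversions l + suc (indexOf v l))
      ≡⟨ cong (λ c → signPow (c + inversions l + suc (indexOf v l))) (countBelow-remove y v∈l ul) ⟩
    signPow (countBelow y [ v ] + countBelow y R + inversions l + suc (indexOf v l))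
      ≡⟨ cong signPow (regroup (countBelow y [ v ]) (countBelow y R) (inversions l) (indexOf v l)) ⟩
    signPow ((inversions l + indexOf v l) + ((countBelow y [ v ] + 1) + countBelow y R))
      ≡⟨ signPow-cong-+ {inversions l + indexOf v l} {inversions (v ∷ R)}
                        {countBelow y [ v ] + 1 + countBelow y R} {countBelow v [ y ] + countBelow y R}
           (inversions-moveToFront v l v∈l ul)
           (signPow-cong-+ {countBelow y [ v ] + 1} {countBelow v [ y ]} {countBelow y R} {countBelow y R}
             (countBelow-swap y≢v) refl) ⟩
    signPow ((countBelow v R + inversions R) + (countBelow v [ y ] + countBelow y R))
      ≡⟨ cong signPow (regroup′ (countBelow v R) (inversions R) (countBelow v [ y ]) (countBelow y R)) ⟩
    signPow ((countBelow v [ y ] + countBelow v R) + (countBelow y R + inversions R))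
      ≡⟨ cong (λ c → signPow (c + inversions (y ∷ R))) (sym (countBelow-∷ v y R)) ⟩
    signPow (inversions (v ∷ y ∷ R))                                  ∎
    where
    open ≡-Reasoning
    R = remove v l
    regroup : ∀ a c i j → a + c + i + suc j ≡ (i + j) + ((a + 1) + c)
    regroup = solve-∀
    regroup′ : ∀ p q s t → (p + q) + (s + t) ≡ (s + p) + (t + q)
    regroup′ = solve-∀

  indexOf-++ˡ : ∀ {v : Fin n} xs ys → v ∈ xs → indexOf v (xs ++ ys) ≡ indexOf v xs
  indexOf-++ˡ {v} (x ∷ xs) ys v∈ with x ≟ v
  ... | yes _ = refl
  indexOf-++ˡ (x ∷ xs) ys (here v≡x)  | no x≢v = ⊥-elim (x≢v (sym v≡x))
  indexOf-++ˡ (x ∷ xs) ys (there v∈) | no _   = cong suc (indexOf-++ˡ xs ys v∈)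

  indexOf-++ʳ : ∀ {v : Fin n} xs ys → ¬ v ∈ xs → indexOf v (xs ++ ys) ≡ length xs + indexOf v ys
  indexOf-++ʳ     []       ys v∉ = refl
  indexOf-++ʳ {v} (x ∷ xs) ys v∉ with x ≟ v
  ... | yes x≡v = ⊥-elim (v∉ (here (sym x≡v)))
  ... | no  _   = cong suc (indexOf-++ʳ xs ys (v∉ ∘ there))

  -- prefixDim counts |V_i| - 1 for each earlier block, so the k missing units come back as toℕ k.
  indexOf-flatten : ∀ {r} (σ : Fin r → List (Fin n)) {v} k →
                    (∀ i → ∃ (_∈ σ i)) → v ∈ σ k → (∀ i → v ∈ σ i → i ≡ k) →
                    prefixDim σ k + indexOf v (σ k) + toℕ k ≡ indexOf v (flatten σ)
  indexOf-flatten σ zero _ v∈ _ = trans (+-identityʳ _) (sym (indexOf-++ˡ (σ zero) (flatten (σ ∘ suc)) v∈))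
  indexOf-flatten σ {v} (suc k) nonempty v∈ onlyIn = begin
    length (σ zero) ∸ 1 + prefixDim (σ ∘ suc) k + indexOf v (σ (suc k)) + suc (toℕ k)
      ≡⟨ regroup (length (σ zero) ∸ 1) (prefixDim (σ ∘ suc) k) (indexOf v (σ (suc k))) (toℕ k) ⟩
    (length (σ zero) ∸ 1 + 1) + (prefixDim (σ ∘ suc) k + indexOf v (σ (suc k)) + toℕ k)
      ≡⟨ cong₂ _+_ (m∸n+n≡m (∈-length (proj₂ (nonempty zero))))
                   (indexOf-flatten (σ ∘ suc) k (nonempty ∘ suc) v∈ (λ i → suc-injective ∘ onlyIn (suc i))) ⟩
    length (σ zero) + indexOf v (flatten (σ ∘ suc))
      ≡⟨ sym (indexOf-++ʳ (σ zero) (flatten (σ ∘ suc)) (0≢1+n ∘ onlyIn zero)) ⟩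
    indexOf v (flatten σ)                                             ∎
    where
    open ≡-Reasoning
    regroup : ∀ a p i t → a + p + i + suc t ≡ (a + 1) + (p + i + t)
    regroup = solve-∀

module _ {r : ℕ} where

  _≟ᵐ_ : DecidableEquality (Maybe (Fin r))
  _≟ᵐ_ = ≡-decᵐ _≟_

  part : ∀ {n} → Vec (Maybe (Fin r)) n → Fin r → List (Fin n)
  part {n} F i = filter (λ u → lookup F u ≟ᵐ just i) (allFin n)

  ∈-part⁺ : ∀ {n} {F : Vec (Maybe (Fin r)) n} {i v} → lookup F v ≡ just i → v ∈ part F i
  ∈-part⁺ {F = F} {i} = ∈-filter⁺ (λ u → lookup F u ≟ᵐ just i) (∈-allFin _)

  ∈-part⁻ : ∀ {n} {F : Vec (Maybe (Fin r)) n} {i v} → v ∈ part F i → lookup F v ≡ just i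
  ∈-part⁻ {n} {F} {i} = proj₂ ∘ ∈-filter⁻ (λ u → lookup F u ≟ᵐ just i) {xs = allFin n}

  part-unique : ∀ {n} (F : Vec (Maybe (Fin r)) n) i → Unique (part F i)
  part-unique {n} F i = filter⁺ (λ u → lookup F u ≟ᵐ just i) {allFin n} (allFin⁺ n)

  part-erase : ∀ {n} (F : Vec (Maybe (Fin r)) n) v i → remove v (part F i) ≡ part (F [ v ]≔ nothing) i
  part-erase {n} F v i =
    trans (filter-filter (λ u → ¬? (u ≟ v)) (λ u → lookup F u ≟ᵐ just i) (allFin n))
          (filter-≐ _ (λ u → lookup (F [ v ]≔ nothing) u ≟ᵐ just i) (kept , kept⁻¹) (allFin n))
    where
    kept : ∀ {u} → u ≢ v × lookup F u ≡ just i → lookup (F [ v ]≔ nothing) u ≡ just i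
    kept (u≢v , Fu≡i) = trans (lookup∘update′ u≢v F nothing) Fu≡i
    kept⁻¹ : ∀ {u} → lookup (F [ v ]≔ nothing) u ≡ just i → u ≢ v × lookup F u ≡ just i
    kept⁻¹ {u} F′u≡i with u ≟ v
    ... | no  u≢v  = u≢v , trans (sym (lookup∘update′ u≢v F nothing)) F′u≡i
    ... | yes refl with trans (sym F′u≡i) (lookup∘update u F nothing)
    ...   | ()

  labelSum : ∀ {n} → Vec (Maybe (Fin r)) n → ℕ
  labelSum F = sum (map (maybe toℕ 0) F)

  labelSum-erase : ∀ {n} (F : Vec (Maybe (Fin r)) n) v →
                   labelSum F ≡ labelSum (F [ v ]≔ nothing) + maybe toℕ 0 (lookup F v)
  labelSum-erase (x ∷ F) zero    = +-comm (maybe toℕ 0 x) (labelSum F)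
  labelSum-erase (x ∷ F) (suc v) =
    trans (cong (maybe toℕ 0 x +_) (labelSum-erase F v)) (sym (+-assoc (maybe toℕ 0 x) _ _))

module _ {N r : ℕ} where

  blocks : Vec (Fin r) (suc N) → Fin r → List (Vertex N)
  blocks T = part (map just T)

  ∈-blocks⁺ : ∀ (T : Vec (Fin r) (suc N)) {k v} → lookup T v ≡ k → v ∈ blocks T k
  ∈-blocks⁺ T {v = v} refl = ∈-part⁺ {F = map just T} (lookup-map v just T)

  ∈-blocks⁻ : ∀ (T : Vec (Fin r) (suc N)) {k v} → v ∈ blocks T k → lookup T v ≡ k
  ∈-blocks⁻ T {v = v} v∈ = just-injective (trans (sym (lookup-map v just T)) (∈-part⁻ {F = map just T} v∈))

  topSign : Vec (Fin r) (suc N) → Sign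
  topSign T = signPow (inversions (flatten (blocks T)) + labelSum (map just T))

  faceSign : Vec (Maybe (Fin r)) (suc N) → Vertex N → Sign
  faceSign F v = signPow (inversions (v ∷ flatten (part F)) + labelSum F)

  canonicalCell : Vec (Fin r) (suc N) → OrientedCell N r
  canonicalCell T = oc (blocks T) (topSign T)

  canonicalOrientation : (T : Vec (Fin r) (suc N)) → Orientation T
  canonicalOrientation T = record
    { cell   = canonicalCell T
    ; unique = part-unique (map just T)
    ; mem    = λ _ _ → mk⇔ (∈-blocks⁻ T) (∈-blocks⁺ T)
    }

  induced-order : ∀ (T : Vec (Fin r) (suc N)) v i →
                  order (induced T (canonicalCell T) v) i ≡ part (face T v) i
  induced-order T v i with i ≟ lookup T v
  ... | yes refl = part-erase (map just T) v i
  ... | no  i≢k  = trans (sym (remove-absent (All.tabulate v∉))) (part-erase (map just T) v i)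
    where
    v∉ : ∀ {u} → u ∈ blocks T i → v ≢ u
    v∉ u∈ refl = i≢k (sym (∈-blocks⁻ T u∈))

  labelSum-face : ∀ (T : Vec (Fin r) (suc N)) v →
                  labelSum (map just T) ≡ labelSum (face T v) + toℕ (lookup T v)
  labelSum-face T v = trans (labelSum-erase (map just T) v)
                            (cong (λ x → labelSum (face T v) + maybe toℕ 0 x) (lookup-map v just T))

  induced-sign : ∀ (T : Vec (Fin r) (suc N)) → IsTopCell T → ∀ v →
                 sign (induced T (canonicalCell T) v) ≡ faceSign (face T v) v
  induced-sign T top v = begin
    topSign T *ₛ signPow P                          ≡⟨ sym (signPow-+ (I + labelSum (map just T)) P) ⟩
    signPow (I + labelSum (map just T) + P)         ≡⟨ cong (λ s → signPow (I + s + P)) (labelSum-face T v) ⟩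
    signPow (I + (labelSum F + toℕ k) + P)          ≡⟨ cong signPow (regroup I (labelSum F) (toℕ k) P) ⟩
    signPow (I + (P + toℕ k) + labelSum F)          ≡⟨ cong (λ j → signPow (I + j + labelSum F)) position ⟩
    signPow (I + indexOf v W + labelSum F)
      ≡⟨ signPow-cong-+ {I + indexOf v W} {inversions (v ∷ remove v W)} {labelSum F} {labelSum F}
           (inversions-moveToFront v W (∈-concat⁺′ v∈k (∈-tabulate⁺ {f = σ} k))
                                       (flatten-unique σ (part-unique (map just T)) disjoint))
           refl ⟩
    signPow (inversions (v ∷ remove v W) + labelSum F)
      ≡⟨ cong (λ w → signPow (inversions (v ∷ w) + labelSum F))
              (trans (remove-flatten v σ) (flatten-cong (part-erase (map just T) v))) ⟩
    faceSign F v                                    ∎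
    where
    open ≡-Reasoning
    σ = blocks T
    k = lookup T v
    F = face T v
    W = flatten σ
    I = inversions W
    P = prefixDim σ k + indexOf v (σ k)
    v∈k : v ∈ σ k
    v∈k = ∈-blocks⁺ T refl
    disjoint : ∀ {i j u} → u ∈ σ i → u ∈ σ j → i ≡ j
    disjoint u∈i u∈j = trans (sym (∈-blocks⁻ T u∈i)) (∈-blocks⁻ T u∈j)
    position : P + toℕ k ≡ indexOf v W
    position = indexOf-flatten σ k (λ i → let (u , Tu≡i) = top i in u , ∈-blocks⁺ T Tu≡i) v∈k
                               (λ i v∈i → sym (∈-blocks⁻ T v∈i))
    regroup : ∀ a b c d → a + (b + c) + d ≡ a + (d + c) + b
    regroup = solve-∀

  face-nothing : ∀ (T : Vec (Fin r) (suc N)) {v u} → lookup (face T v) u ≡ nothing → u ≡ v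
  face-nothing T {v} {u} Fu≡nothing with u ≟ v
  ... | yes u≡v = u≡v
  ... | no  u≢v with trans (sym (lookup-map u just T))
                           (trans (sym (lookup∘update′ u≢v (map just T) nothing)) Fu≡nothing)
  ...   | ()

  face≡⇒vertex≡ : ∀ {T T′ : Vec (Fin r) (suc N)} {v v′} → face T v ≡ face T′ v′ → v ≡ v′
  face≡⇒vertex≡ {T} {T′} {v′ = v′} eq =
    sym (face-nothing T (trans (cong (λ F → lookup F v′) eq) (lookup∘update v′ (map just T′) nothing)))

  induced-agree : ∀ (T T′ : Vec (Fin r) (suc N)) → IsTopCell T → IsTopCell T′ → ∀ {v v′} →
                  face T v ≡ face T′ v′ →
                  SameOrientation (induced T (canonicalCell T) v) (induced T′ (canonicalCell T′) v′)
  induced-agree T T′ top top′ {v} eq with face≡⇒vertex≡ {T} {T′} eq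
  ... | refl = ↭-reflexive ∘ orders , cong₂ _*ₛ_ signs (prodSign-cong (cong orderSign ∘ orders))
    where
    orders : ∀ i → order (induced T (canonicalCell T) v) i ≡ order (induced T′ (canonicalCell T′) v) i
    orders i = trans (induced-order T v i) (trans (cong (λ F → part F i) eq) (sym (induced-order T′ v i)))
    signs : sign (induced T (canonicalCell T) v) ≡ sign (induced T′ (canonicalCell T′) v)
    signs = trans (induced-sign T top v) (trans (cong (λ F → faceSign F v) eq) (sym (induced-sign T′ top′ v)))

mainTheorem1 : ∀ (N r : ℕ) → 1 ≤ N → 2 ≤ r → r ≤ suc N → OOrientable N r
mainTheorem1 N r _ _ _ =
  (λ T _ → canonicalOrientation T) ,
  λ T T′ top top′ v v′ _ _ → induced-agree T T′ top top′
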